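{- Fix integers $\delta,\Delta$ with $1\le\delta\le\Delta$. (i) There exists a graph $G$ with minimum degree $\delta$ and maximum degree $\Delta$ such that every rumor spreading algorithm requires $\Omega(\Delta/(\delta\cdot\phi))$ rounds in the mobile telephone model on $G$, where $\phi$ is the graph conductance of $G$. (ii) For every connected graph with minimum degree $\delta$, maximum degree $\Delta$ and graph conductance $\phi$, on $n$ vertices, the optimal rumor spreading algorithm terminates in $O(\Delta/(\delta\cdot\phi)\cdot\log n)$ rounds in the mobile telephone model.
   Context: For a graph $G=(V,E)$, $d(u)=|N(u)|$, $vol(S)=\sum_{u\in S}d(u)$, $cut(S,V\setminus S)$ is the number of edges with exactly one endpoint in $S$, and the graph conductance is $\phi=\min_{S\subseteq V,\,0<vol(S)\le vol(V)/2} cut(S,V\setminus S)/vol(S)$. Mobile telephone model (static topology): synchronous rounds; each node may send a connection proposal to at most one neighbor; a node that sends a proposal cannot receive one; a node that sent no proposal and received at least one may accept at most one; connected pairs exchange unbounded information. Rumor spreading: a single source starts with a rumor; solved once all nodes know it, information passing only across connections. -}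

module Defs where

open import Data.Nat using (ℕ; zero; suc; _+_; _*_; _≤_; _<_)
open import Data.Nat.Logarithm using (⌈log₂_⌉)
open import Data.Integer using (+_)
open import Data.Rational using (ℚ; _/_) renaming (_*_ to _*ℚ_; _≤_ to _≤ℚ_)
open import Data.Fin using (Fin; _≟_)
open import Data.Bool using (Bool; true; false; if_then_else_; _∧_; _∨_; not)
open import Data.Maybe using (Maybe; just; nothing)
open import Data.Vec using (Vec; []; _∷_)
open import Data.Product using (Σ; ∃; _×_; _,_)
open import Relation.Nullary.Decidable using (⌊_⌋)
open import Relation.Binary.PropositionalEquality using (_≡_)

ℕtoℚ : ℕ → ℚ
ℕtoℚ n = + n / 1

record Graph (n : ℕ) : Set where
  field
    adj    : Fin n → Fin n → Bool
    sym    : ∀ u v → adj u v ≡ adj v u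
    irrefl : ∀ u → adj u u ≡ false
open Graph public

sumFin : ∀ {n} → (Fin n → ℕ) → ℕ
sumFin {zero}  f = 0
sumFin {suc n} f = f Fin.zero + sumFin (λ i → f (Fin.suc i))

deg : ∀ {n} → Graph n → Fin n → ℕ
deg G u = sumFin (λ v → if adj G u v then 1 else 0)

Subset : ℕ → Set
Subset n = Fin n → Bool

vol : ∀ {n} → Graph n → Subset n → ℕ
vol G S = sumFin (λ u → if S u then deg G u else 0)

-- number of edges with exactly one endpoint in S (counted with the S-endpoint first)
cut : ∀ {n} → Graph n → Subset n → ℕ
cut G S = sumFin (λ u → sumFin (λ v → if S u ∧ not (S v) ∧ adj G u v then 1 else 0))

fullSet : ∀ {n} → Subset n
fullSet _ = true

Admissible : ∀ {n} → Graph n → Subset n → Set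
Admissible G S = (0 < vol G S) × (2 * vol G S ≤ vol G fullSet)

-- φ = min over admissible S of cut(S)/vol(S)   (ratio cleared of the positive denominator)
IsConductance : ∀ {n} → Graph n → ℚ → Set
IsConductance G φ =
  (Σ (Subset _) λ S → Admissible G S × (φ *ℚ ℕtoℚ (vol G S) ≡ ℕtoℚ (cut G S)))
  × (∀ S → Admissible G S → φ *ℚ ℕtoℚ (vol G S) ≤ℚ ℕtoℚ (cut G S))

MinDegree : ∀ {n} → Graph n → ℕ → Set
MinDegree G δ = (∀ u → δ ≤ deg G u) × ∃ (λ u → deg G u ≡ δ)

MaxDegree : ∀ {n} → Graph n → ℕ → Set
MaxDegree G Δ = (∀ u → deg G u ≤ Δ) × ∃ (λ u → deg G u ≡ Δ)

data Walk {n} (G : Graph n) : Fin n → Fin n → Set where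
  here : ∀ {u} → Walk G u u
  step : ∀ {u v w} → adj G u v ≡ true → Walk G v w → Walk G u w

Connected : ∀ {n} → Graph n → Set
Connected G = ∀ u v → Walk G u v

-- One round of the mobile telephone model: the set of established connections.
-- Each node is in at most one connection and connections are along edges, i.e. a matching
-- (every matching is realizable: one endpoint of each edge proposes, the other accepts).
record Round {n} (G : Graph n) : Set where
  field
    partner : Fin n → Maybe (Fin n)
    onEdge  : ∀ u v → partner u ≡ just v → adj G u v ≡ true
    symm    : ∀ u v → partner u ≡ just v → partner v ≡ just u
open Round public

learnFrom : ∀ {n} → (Fin n → Bool) → Maybe (Fin n) → Bool
learnFrom I nothing  = false
learnFrom I (just u) = I u

stepRound : ∀ {n} {G : Graph n} → Round G → (Fin n → Bool) → (Fin n → Bool)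
stepRound r I v = I v ∨ learnFrom I (partner r v)

runRounds : ∀ {n} {G : Graph n} {T} → Vec (Round G) T → (Fin n → Bool) → (Fin n → Bool)
runRounds []       I = I
runRounds (r ∷ rs) I = runRounds rs (stepRound r I)

initial : ∀ {n} → Fin n → (Fin n → Bool)
initial s v = ⌊ v ≟ s ⌋

-- rumor spreading from source s can be solved in T rounds (by some, e.g. optimal, algorithm)
SolvableIn : ∀ {n} → Graph n → Fin n → ℕ → Set
SolvableIn G s T = Σ (Vec (Round G) T) λ rs → ∀ v → runRounds rs (initial s) v ≡ true

-- Upper bound: in each round, greedily match every uninformed vertex to a still free informed
-- neighbour. Every edge leaving the informed set I then has a matched endpoint carrying at most Δ
-- such edges, so at least cut(I) / 2Δ vertices learn. As cut(I) ≥ φ vol ≥ φ δ |side| for the side of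
-- smaller volume, within K = ⌈2Δ / (δ φ)⌉ rounds the informed set doubles or the uninformed set
-- halves, so 2 K ⌈log₂ n⌉ rounds suffice.
-- Lower bound: in K_{δ,Δ} with the source among the δ vertices of degree Δ, a round is a matching
-- across the two sides, so at most δ of the Δ other vertices learn per round, while the conductance
-- is at least 1/2 because vol S ≤ 2 cut S for every admissible S (by AM-GM).

module Submission where

open import Data.Bool using (Bool; true; false; if_then_else_; _∧_; _∨_; not; _xor_)
open import Data.Bool.Properties using (⇔→≡; ∧-zeroʳ) renaming (_≟_ to _≟ᵇ_)
open import Data.Empty using (⊥-elim)
open import Data.Fin using (Fin; zero; suc; _≟_; _↑ˡ_; _↑ʳ_; splitAt; fromℕ<)
open import Data.Fin.Properties using (any?; splitAt-↑ˡ; splitAt-↑ʳ)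
open import Data.List using (List; []; _∷_; map; _++_; allFin)
open import Data.List.Membership.Propositional using (_∈_)
open import Data.List.Membership.Propositional.Properties using (∈-allFin; ∈-map⁺; ∈-++⁺ˡ; ∈-++⁺ʳ)
open import Data.List.Relation.Unary.Any using (here; there)
import Data.Integer as ℤ
import Data.Integer.Properties as ℤP
open import Data.Maybe using (Maybe; just; nothing; is-just)
open import Data.Nat hiding (_≟_)
open import Data.Nat.Properties hiding (_≟_)
open import Data.Nat.DivMod using (_/_; _%_; m≡m%n+[m/n]*n; m%n<n; m/n*n≤m)
open import Data.Nat.Logarithm using (⌈log₂_⌉)
open import Data.Nat.Logarithm.Core using (⌈log2⌉)
open import Data.Nat.Tactic.RingSolver using (solve-∀)
open import Data.Product using (Σ; ∃; _×_; _,_; proj₁; proj₂)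
open import Data.Rational using (ℚ; Positive; 1/_; toℚᵘ; ½) renaming (_*_ to _*ℚ_; _≤_ to _≤ℚ_)
import Data.Rational.Properties as ℚP
import Data.Rational.Unnormalised as ℚᵘ
import Data.Rational.Unnormalised.Properties as ℚᵘP
open import Data.Sum using (_⊎_; inj₁; inj₂; isInj₁)
open import Data.Vec using (Vec; []; _∷_)
open import Function.Bundles using (_⇔_; mk⇔; module Equivalence)
open import Induction.WellFounded using (Acc; acc)
open import Relation.Binary.PropositionalEquality
open import Relation.Nullary using (¬_)
open import Relation.Nullary.Decidable using (Dec; ⌊_⌋; yes; no; _×-dec_; _⊎-dec_)

open import Defs hiding (sym)

𝟙 : Bool → ℕ
𝟙 b = if b then 1 else 0

𝟙≤1 : ∀ b → 𝟙 b ≤ 1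
𝟙≤1 true  = ≤-refl
𝟙≤1 false = z≤n

sumFin-cong : ∀ {m} {f g : Fin m → ℕ} → (∀ i → f i ≡ g i) → sumFin f ≡ sumFin g
sumFin-cong {zero}  e = refl
sumFin-cong {suc m} e = cong₂ _+_ (e zero) (sumFin-cong (λ i → e (suc i)))

sumFin-mono : ∀ {m} {f g : Fin m → ℕ} → (∀ i → f i ≤ g i) → sumFin f ≤ sumFin g
sumFin-mono {zero}  e = z≤n
sumFin-mono {suc m} e = +-mono-≤ (e zero) (sumFin-mono (λ i → e (suc i)))

sumFin-const : ∀ {m} k → sumFin {m} (λ _ → k) ≡ m * k
sumFin-const {zero}  k = refl
sumFin-const {suc m} k = cong (k +_) (sumFin-const {m} k)

sumFin-zero : ∀ {m} → sumFin {m} (λ _ → 0) ≡ 0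
sumFin-zero {m} = trans (sumFin-const {m} 0) (*-zeroʳ m)

sumFin-one : ∀ {m} → sumFin {m} (λ _ → 1) ≡ m
sumFin-one {m} = trans (sumFin-const {m} 1) (*-identityʳ m)

sumFin-+ : ∀ {m} (f g : Fin m → ℕ) → sumFin (λ i → f i + g i) ≡ sumFin f + sumFin g
sumFin-+ {zero}  f g = refl
sumFin-+ {suc m} f g rewrite sumFin-+ (λ i → f (suc i)) (λ i → g (suc i)) =
  interchange (f zero) (g zero) _ _
  where
  interchange : ∀ a b c d → a + b + (c + d) ≡ a + c + (b + d)
  interchange = solve-∀

sumFin-*ˡ : ∀ {m} k (f : Fin m → ℕ) → sumFin (λ i → k * f i) ≡ k * sumFin f
sumFin-*ˡ {zero}  k f = sym (*-zeroʳ k)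
sumFin-*ˡ {suc m} k f rewrite sumFin-*ˡ k (λ i → f (suc i)) = sym (*-distribˡ-+ k (f zero) _)

sumFin-*ʳ : ∀ {m} (f : Fin m → ℕ) k → sumFin (λ i → f i * k) ≡ sumFin f * k
sumFin-*ʳ f k = trans (sumFin-cong (λ i → *-comm (f i) k)) (trans (sumFin-*ˡ k f) (*-comm k _))

sumFin-swap : ∀ {m p} (h : Fin m → Fin p → ℕ) →
  sumFin (λ i → sumFin (λ j → h i j)) ≡ sumFin (λ j → sumFin (λ i → h i j))
sumFin-swap {zero}  {p} h = sym (sumFin-zero {p})
sumFin-swap {suc m} {p} h =
  trans (cong (sumFin (h zero) +_) (sumFin-swap (λ i j → h (suc i) j)))
        (sym (sumFin-+ (h zero) (λ j → sumFin (λ i → h (suc i) j))))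

≤-sumFin : ∀ {m} (f : Fin m → ℕ) i → f i ≤ sumFin f
≤-sumFin f zero    = m≤m+n _ _
≤-sumFin f (suc i) = ≤-trans (≤-sumFin (λ j → f (suc j)) i) (m≤n+m _ (f zero))

sumFin-pos : ∀ {m} (f : Fin m → ℕ) → 0 < sumFin f → ∃ λ i → 0 < f i
sumFin-pos {suc m} f p with f zero in eq
... | suc _ = zero , subst (0 <_) (sym eq) z<s
... | zero with sumFin-pos (λ j → f (suc j)) p
...   | i , q = suc i , q

sumFin-pick : ∀ {m} (w : Fin m) (f : Fin m → ℕ) →
  sumFin (λ v → if ⌊ v ≟ w ⌋ then f v else 0) ≡ f w
sumFin-pick {suc m} zero f =
  trans (cong (f zero +_) (trans (sumFin-cong {m} {g = λ _ → 0} (λ _ → refl)) (sumFin-zero {m})))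
        (+-identityʳ _)
sumFin-pick {suc m} (suc w) f =
  trans (sumFin-cong shift) (sumFin-pick w (λ v → f (suc v)))
  where
  shift : ∀ v → (if ⌊ suc v ≟ suc w ⌋ then f (suc v) else 0) ≡ (if ⌊ v ≟ w ⌋ then f (suc v) else 0)
  shift v with v ≟ w
  ... | yes refl = refl
  ... | no _     = refl

sumFin-↑ : ∀ a b (f : Fin (a + b) → ℕ) →
  sumFin f ≡ sumFin (λ i → f (i ↑ˡ b)) + sumFin (λ j → f (a ↑ʳ j))
sumFin-↑ zero    b f = refl
sumFin-↑ (suc a) b f =
  trans (cong (f zero +_) (sumFin-↑ a b (λ i → f (suc i)))) (sym (+-assoc (f zero) _ _))

size : ∀ {n} → Subset n → ℕ
size S = sumFin (λ u → 𝟙 (S u))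

∁ : ∀ {n} → Subset n → Subset n
∁ S u = not (S u)

size≤n : ∀ {n} (S : Subset n) → size S ≤ n
size≤n {n} S = ≤-trans (sumFin-mono (λ u → 𝟙≤1 (S u))) (≤-reflexive (sumFin-one {n}))

size-∁ : ∀ {n} (S : Subset n) → size S + size (∁ S) ≡ n
size-∁ {n} S = trans (sym (sumFin-+ {n} _ _)) (trans (sumFin-cong (λ u → split (S u))) (sumFin-one {n}))
  where
  split : ∀ b → 𝟙 b + 𝟙 (not b) ≡ 1
  split true  = refl
  split false = refl

size-initial : ∀ {n} (s : Fin n) → size (initial s) ≡ 1
size-initial s = sumFin-pick s (λ _ → 1)

size≡n⇒full : ∀ {n} (S : Subset n) → size S ≡ n → ∀ v → S v ≡ true
size≡n⇒full S full v with S v in Sv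
... | true  = refl
... | false = ⊥-elim (<-irrefl full (subst (size S <_) (size-∁ S) (m<m+n (size S) v∈∁S)))
  where
  v∈∁S : 1 ≤ size (∁ S)
  v∈∁S = ≤-trans (≤-reflexive (cong (λ b → 𝟙 (not b)) (sym Sv))) (≤-sumFin (λ u → 𝟙 (not (S u))) v)

module _ {n} (G : Graph n) where

  δ*size≤vol : ∀ δ → (∀ u → δ ≤ deg G u) → (S : Subset n) → δ * size S ≤ vol G S
  δ*size≤vol δ δ≤deg S = subst (_≤ vol G S) (sumFin-*ˡ δ (λ u → 𝟙 (S u))) (sumFin-mono pointwise)
    where
    pointwise : ∀ u → δ * 𝟙 (S u) ≤ (if S u then deg G u else 0)
    pointwise u with S u
    ... | true  = subst (_≤ deg G u) (sym (*-identityʳ δ)) (δ≤deg u)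
    ... | false = subst (_≤ 0) (sym (*-zeroʳ δ)) z≤n

  vol-∁ : (S : Subset n) → vol G S + vol G (∁ S) ≡ vol G fullSet
  vol-∁ S = trans (sym (sumFin-+ {n} _ _)) (sumFin-cong pointwise)
    where
    pointwise : ∀ u → (if S u then deg G u else 0) + (if not (S u) then deg G u else 0) ≡ deg G u
    pointwise u with S u
    ... | true  = +-identityʳ _
    ... | false = refl

  cut-∁ : (S : Subset n) → cut G S ≡ cut G (∁ S)
  cut-∁ S = trans (sumFin-swap {n} {n} _) (sumFin-cong λ v → sumFin-cong λ u → pointwise u v)
    where
    pointwise : ∀ u v → 𝟙 (S u ∧ not (S v) ∧ adj G u v) ≡ 𝟙 (not (S v) ∧ not (not (S u)) ∧ adj G v u)
    pointwise u v rewrite Graph.sym G u v with S u | S v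
    ... | true  | true  = refl
    ... | true  | false = refl
    ... | false | true  = refl
    ... | false | false = refl

  cut≤vol : (S : Subset n) → cut G S ≤ vol G S
  cut≤vol S = sumFin-mono pointwise
    where
    drop : ∀ a b → 𝟙 (not a ∧ b) ≤ 𝟙 b
    drop true  b = z≤n
    drop false b = ≤-refl
    pointwise : ∀ u → sumFin (λ v → 𝟙 (S u ∧ not (S v) ∧ adj G u v)) ≤ (if S u then deg G u else 0)
    pointwise u with S u
    ... | true  = sumFin-mono (λ v → drop (S v) (adj G u v))
    ... | false = ≤-reflexive (sumFin-zero {n})

  vol-pos⇒∃ : (S : Subset n) → 0 < vol G S → ∃ λ u → S u ≡ true
  vol-pos⇒∃ S p with sumFin-pos (λ u → if S u then deg G u else 0) p
  ... | u , _ with S u in Su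
  ...   | true = u , Su

  crossing-edge⇒cut-pos : (S : Subset n) → ∀ {u v} → S u ≡ true → S v ≡ false →
    adj G u v ≡ true → 1 ≤ cut G S
  crossing-edge⇒cut-pos S {u} {v} Su Sv uv =
    ≤-trans (≤-trans edge (≤-sumFin _ v)) (≤-sumFin (λ u → sumFin (λ v → 𝟙 (S u ∧ not (S v) ∧ adj G u v))) u)
    where
    edge : 1 ≤ 𝟙 (S u ∧ not (S v) ∧ adj G u v)
    edge rewrite Su | Sv | uv = ≤-refl

  walk⇒cut-pos : (S : Subset n) → ∀ {u v} → Walk G u v → S u ≡ true → S v ≡ false → 1 ≤ cut G S
  walk⇒cut-pos S here Su Sv with () ← trans (sym Su) Sv
  walk⇒cut-pos S (step {v = w} uw rest) Su Sv with S w in Sw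
  ... | true  = walk⇒cut-pos S rest Sw Sv
  ... | false = crossing-edge⇒cut-pos S Su Sw uw

-- Greedy rounds

matched : ∀ {n} → Maybe (Fin n) → Bool
matched (just _) = true
matched nothing  = false

_≐_ : ∀ {n} → Maybe (Fin n) → Fin n → Bool
just w  ≐ u = ⌊ u ≟ w ⌋
nothing ≐ u = false

≐⇔≡just : ∀ {n} (mb : Maybe (Fin n)) u → (mb ≐ u) ≡ true ⇔ mb ≡ just u
≐⇔≡just nothing  u = mk⇔ (λ ()) (λ ())
≐⇔≡just (just w) u with u ≟ w
... | yes refl = mk⇔ (λ _ → refl) (λ _ → refl)
... | no  u≢w  = mk⇔ (λ ()) (λ { refl → ⊥-elim (u≢w refl) })

learnFrom-const : ∀ {n} (b : Bool) (mb : Maybe (Fin n)) → learnFrom (λ _ → b) mb ≡ matched mb ∧ b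
learnFrom-const b (just _) = refl
learnFrom-const b nothing  = refl

sumFin-≐ : ∀ {m} (mb : Maybe (Fin m)) (X : Fin m → Bool) →
  sumFin (λ u → 𝟙 (mb ≐ u ∧ X u)) ≡ 𝟙 (learnFrom X mb)
sumFin-≐ {m} nothing  X = sumFin-zero {m}
sumFin-≐ {m} (just w) X = trans (sumFin-cong pointwise) (sumFin-pick w (λ u → 𝟙 (X u)))
  where
  pointwise : ∀ u → 𝟙 (⌊ u ≟ w ⌋ ∧ X u) ≡ (if ⌊ u ≟ w ⌋ then 𝟙 (X u) else 0)
  pointwise u with ⌊ u ≟ w ⌋
  ... | true  = refl
  ... | false = refl

module _ {n} {G : Graph n} (r : Round G) where

  partner-≐-sym : ∀ u v → (partner r v ≐ u) ≡ (partner r u ≐ v)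
  partner-≐-sym u v = ⇔→≡ (mk⇔
    (λ e → from (≐⇔≡just (partner r u) v) (symm r v u (to (≐⇔≡just (partner r v) u) e)))
    (λ e → from (≐⇔≡just (partner r v) u) (symm r u v (to (≐⇔≡just (partner r u) v) e))))
    where open Equivalence

  -- A round is a matching, so the learners from X are in bijection with the matched vertices of X.
  learners-count : (X : Subset n) →
    sumFin (λ v → 𝟙 (learnFrom X (partner r v))) ≡ sumFin (λ u → 𝟙 (matched (partner r u) ∧ X u))
  learners-count X = begin
      sumFin (λ v → 𝟙 (learnFrom X (p v)))
    ≡⟨ sumFin-cong (λ v → sym (sumFin-≐ (p v) X)) ⟩
      sumFin (λ v → sumFin (λ u → 𝟙 (p v ≐ u ∧ X u)))
    ≡⟨ sumFin-swap {n} {n} _ ⟩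
      sumFin (λ u → sumFin (λ v → 𝟙 (p v ≐ u ∧ X u)))
    ≡⟨ sumFin-cong (λ u → sumFin-cong (λ v → cong (λ b → 𝟙 (b ∧ X u)) (partner-≐-sym u v))) ⟩
      sumFin (λ u → sumFin (λ v → 𝟙 (p u ≐ v ∧ X u)))
    ≡⟨ sumFin-cong (λ u → trans (sumFin-≐ (p u) (λ _ → X u)) (cong 𝟙 (learnFrom-const (X u) (p u)))) ⟩
      sumFin (λ u → 𝟙 (matched (p u) ∧ X u))
    ∎
    where
    open ≡-Reasoning
    p = partner r

module GreedyRound {n} (G : Graph n) (I : Subset n) where

  Pairing : Set
  Pairing = Fin n → Maybe (Fin n)

  record Valid (p : Pairing) : Set where
    field
      pairs-sym   : ∀ u v → p u ≡ just v → p v ≡ just u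
      pairs-adj   : ∀ u v → p u ≡ just v → adj G u v ≡ true
      pairs-cross : ∀ u v → p u ≡ just v → I v ≡ not (I u)
  open Valid

  _⊑_ : Pairing → Pairing → Set
  p ⊑ q = ∀ x y → p x ≡ just y → q x ≡ just y

  Saturated : Pairing → Fin n → Set
  Saturated p v = I v ≡ false →
    matched (p v) ≡ true ⊎ (∀ u → I u ≡ true → adj G v u ≡ true → matched (p u) ≡ true)

  FreePartner : Pairing → Fin n → Fin n → Set
  FreePartner p v u = I u ≡ true × adj G v u ≡ true × matched (p u) ≡ false

  freePartner? : ∀ p v → Dec (∃ (FreePartner p v))
  freePartner? p v = any? λ u → (I u ≟ᵇ true) ×-dec (adj G v u ≟ᵇ true) ×-dec (matched (p u) ≟ᵇ false)

  link : Fin n → Fin n → Pairing → Pairing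
  link v u p x = if ⌊ x ≟ v ⌋ then just u else if ⌊ x ≟ u ⌋ then just v else p x

  extend : Fin n → Pairing → Pairing
  extend v p with I v | p v
  ... | true  | _      = p
  ... | false | just _ = p
  ... | false | nothing with freePartner? p v
  ...   | yes (u , _) = link v u p
  ...   | no  _       = p

  unmatched⇒nothing : ∀ {mb : Maybe (Fin n)} → matched mb ≡ false → mb ≡ nothing
  unmatched⇒nothing {nothing} refl = refl

  module Link {p v u} (valid : Valid p) (pv : p v ≡ nothing) (Iv : I v ≡ false)
              (free : FreePartner p v u) where

    Iu : I u ≡ true
    Iu = proj₁ free

    pu : p u ≡ nothing
    pu = unmatched⇒nothing (proj₂ (proj₂ free))

    u≢v : ¬ u ≡ v
    u≢v refl with () ← trans (sym Iu) Iv

    at-v : link v u p v ≡ just u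
    at-v with v ≟ v
    ... | yes _  = refl
    ... | no v≢v = ⊥-elim (v≢v refl)

    at-u : link v u p u ≡ just v
    at-u with u ≟ v
    ... | yes u≡v = ⊥-elim (u≢v u≡v)
    ... | no _ with u ≟ u
    ...   | yes _  = refl
    ...   | no u≢u = ⊥-elim (u≢u refl)

    elsewhere : ∀ x → ¬ x ≡ v → ¬ x ≡ u → link v u p x ≡ p x
    elsewhere x x≢v x≢u with x ≟ v
    ... | yes x≡v = ⊥-elim (x≢v x≡v)
    ... | no _ with x ≟ u
    ...   | yes x≡u = ⊥-elim (x≢u x≡u)
    ...   | no _    = refl

    grows : p ⊑ link v u p
    grows x y pxy = trans (elsewhere x x≢v x≢u) pxy
      where
      x≢v : ¬ x ≡ v
      x≢v refl with () ← trans (sym pxy) pv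
      x≢u : ¬ x ≡ u
      x≢u refl with () ← trans (sym pxy) pu

    valid′ : Valid (link v u p)
    valid′ = record { pairs-sym = sym′ ; pairs-adj = adj′ ; pairs-cross = cross′ }
      where
      sym′ : ∀ x y → link v u p x ≡ just y → link v u p y ≡ just x
      sym′ x y e with x ≟ v
      ... | yes refl with refl ← e = at-u
      ... | no _ with x ≟ u
      ...   | yes refl with refl ← e = at-v
      ...   | no _ = grows y x (pairs-sym valid x y e)
      adj′ : ∀ x y → link v u p x ≡ just y → adj G x y ≡ true
      adj′ x y e with x ≟ v
      ... | yes refl with refl ← e = proj₁ (proj₂ free)
      ... | no _ with x ≟ u
      ...   | yes refl with refl ← e = trans (Graph.sym G u v) (proj₁ (proj₂ free))
      ...   | no _ = pairs-adj valid x y e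
      cross′ : ∀ x y → link v u p x ≡ just y → I y ≡ not (I x)
      cross′ x y e with x ≟ v
      ... | yes refl with refl ← e rewrite Iu | Iv = refl
      ... | no _ with x ≟ u
      ...   | yes refl with refl ← e rewrite Iu | Iv = refl
      ...   | no _ = pairs-cross valid x y e

  ⊑-refl : ∀ {p} → p ⊑ p
  ⊑-refl _ _ e = e

  just⇒matched : ∀ {mb : Maybe (Fin n)} {y} → mb ≡ just y → matched mb ≡ true
  just⇒matched refl = refl

  extend-spec : ∀ v p → Valid p → Valid (extend v p) × p ⊑ extend v p × Saturated (extend v p) v
  extend-spec v p valid with I v in Iv | p v in pv
  ... | true  | _      = valid , ⊑-refl , λ ()
  ... | false | just _ = valid , ⊑-refl , λ _ → inj₁ (just⇒matched pv)
  ... | false | nothing with freePartner? p v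
  ...   | yes (u , free) = valid′ , grows , λ _ → inj₁ (just⇒matched at-v)
    where open Link valid pv Iv free
  ...   | no none = valid , ⊑-refl , λ _ → inj₂ noFreeNeighbour
    where
    noFreeNeighbour : ∀ u → I u ≡ true → adj G v u ≡ true → matched (p u) ≡ true
    noFreeNeighbour u Iu vu with matched (p u) in pu
    ... | true  = refl
    ... | false = ⊥-elim (none (u , Iu , vu , pu))

  matched-⊑ : ∀ {p q} → p ⊑ q → ∀ x → matched (p x) ≡ true → matched (q x) ≡ true
  matched-⊑ {p} p⊑q x _ with p x in px
  ... | just y = just⇒matched (p⊑q x y px)

  Saturated-⊑ : ∀ {p q} v → p ⊑ q → Saturated p v → Saturated q v
  Saturated-⊑ v p⊑q sat Iv with sat Iv
  ... | inj₁ matched-v = inj₁ (matched-⊑ p⊑q v matched-v)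
  ... | inj₂ nbrs      = inj₂ (λ u Iu vu → matched-⊑ p⊑q u (nbrs u Iu vu))

  extendAll : List (Fin n) → Pairing → Pairing
  extendAll []       p = p
  extendAll (v ∷ vs) p = extendAll vs (extend v p)

  extendAll-spec : ∀ vs p → Valid p → Valid (extendAll vs p) × p ⊑ extendAll vs p
  extendAll-spec []       p valid = valid , ⊑-refl
  extendAll-spec (v ∷ vs) p valid with extend-spec v p valid
  ... | valid₁ , p⊑p₁ , _ with extendAll-spec vs (extend v p) valid₁
  ...   | valid₂ , p₁⊑p₂ = valid₂ , λ x y e → p₁⊑p₂ x y (p⊑p₁ x y e)

  extendAll-saturated : ∀ vs p → Valid p → ∀ v → v ∈ vs → Saturated (extendAll vs p) v
  extendAll-saturated (v ∷ vs) p valid v (here refl) with extend-spec v p valid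
  ... | valid₁ , _ , sat = Saturated-⊑ v (proj₂ (extendAll-spec vs (extend v p) valid₁)) sat
  extendAll-saturated (w ∷ vs) p valid v (there v∈vs) =
    extendAll-saturated vs (extend w p) (proj₁ (extend-spec w p valid)) v v∈vs

  pairing : Pairing
  pairing = extendAll (allFin n) (λ _ → nothing)

  empty-valid : Valid (λ _ → nothing)
  empty-valid = record { pairs-sym = λ _ _ () ; pairs-adj = λ _ _ () ; pairs-cross = λ _ _ () }

  valid : Valid pairing
  valid = proj₁ (extendAll-spec (allFin n) _ empty-valid)

  saturated : ∀ v → Saturated pairing v
  saturated v = extendAll-saturated (allFin n) _ empty-valid v (∈-allFin v)

  round : Round G
  round = record { partner = pairing ; onEdge = pairs-adj valid ; symm = pairs-sym valid }

module RoundProgress {n} (G : Graph n) (I : Subset n) where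
  open GreedyRound G I
  open Valid valid

  learned : ℕ
  learned = sumFin (λ v → 𝟙 (not (I v) ∧ learnFrom I (pairing v)))

  size-stepRound : size (stepRound round I) ≡ size I + learned
  size-stepRound = trans (sumFin-cong pointwise) (sumFin-+ {n} _ _)
    where
    pointwise : ∀ v → 𝟙 (I v ∨ learnFrom I (pairing v)) ≡ 𝟙 (I v) + 𝟙 (not (I v) ∧ learnFrom I (pairing v))
    pointwise v with I v
    ... | true  = refl
    ... | false = refl

  matchedInformed matchedUninformed : ℕ
  matchedInformed   = sumFin (λ u → 𝟙 (matched (pairing u) ∧ I u))
  matchedUninformed = sumFin (λ v → 𝟙 (matched (pairing v) ∧ not (I v)))

  matchedInformed≡learned : matchedInformed ≡ learned
  matchedInformed≡learned = trans (sym (learners-count round I)) (sumFin-cong pointwise)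
    where
    pointwise : ∀ v → 𝟙 (learnFrom I (pairing v)) ≡ 𝟙 (not (I v) ∧ learnFrom I (pairing v))
    pointwise v with pairing v in pv
    ... | nothing = cong 𝟙 (sym (∧-zeroʳ (not (I v))))
    ... | just w rewrite pairs-cross v w pv with I v
    ...   | true  = refl
    ...   | false = refl

  matchedUninformed≡learned : matchedUninformed ≡ learned
  matchedUninformed≡learned = sumFin-cong pointwise
    where
    pointwise : ∀ v → 𝟙 (matched (pairing v) ∧ not (I v)) ≡ 𝟙 (not (I v) ∧ learnFrom I (pairing v))
    pointwise v with I v in Iv | pairing v in pv
    ... | true  | nothing = refl
    ... | true  | just _  = refl
    ... | false | nothing = refl
    ... | false | just w rewrite pairs-cross v w pv | Iv = refl

  -- Saturation puts a matched endpoint on every cut edge; a matched vertex carries at most Δ of them.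
  cut≤Δ*2learned : ∀ Δ → (∀ u → deg G u ≤ Δ) → cut G I ≤ Δ * (learned + learned)
  cut≤Δ*2learned Δ deg≤Δ = begin
      cut G I
    ≤⟨ sumFin-mono {n} (λ u → sumFin-mono {n} (λ v → cutEdge u v)) ⟩
      sumFin (λ u → sumFin (λ v → a u * 𝟙 (adj G u v) + b v * 𝟙 (adj G v u)))
    ≡⟨ sumFin-cong {n} (λ u → sumFin-+ {n} _ _) ⟩
      sumFin (λ u → sumFin (λ v → a u * 𝟙 (adj G u v)) + sumFin (λ v → b v * 𝟙 (adj G v u)))
    ≡⟨ sumFin-+ {n} _ _ ⟩
      sumFin (λ u → sumFin (λ v → a u * 𝟙 (adj G u v))) + sumFin (λ u → sumFin (λ v → b v * 𝟙 (adj G v u)))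
    ≡⟨ cong₂ _+_ (sumFin-cong (λ u → sumFin-*ˡ {n} (a u) _))
                 (trans (sumFin-swap {n} {n} _) (sumFin-cong (λ v → sumFin-*ˡ {n} (b v) _))) ⟩
      sumFin (λ u → a u * deg G u) + sumFin (λ v → b v * deg G v)
    ≤⟨ +-mono-≤ (sumFin-mono (λ u → *-monoʳ-≤ (a u) (deg≤Δ u))) (sumFin-mono (λ v → *-monoʳ-≤ (b v) (deg≤Δ v))) ⟩
      sumFin (λ u → a u * Δ) + sumFin (λ v → b v * Δ)
    ≡⟨ cong₂ _+_ (sumFin-*ʳ a Δ) (sumFin-*ʳ b Δ) ⟩
      matchedInformed * Δ + matchedUninformed * Δ
    ≡⟨ sym (*-distribʳ-+ Δ matchedInformed matchedUninformed) ⟩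
      (matchedInformed + matchedUninformed) * Δ
    ≡⟨ cong₂ (λ x y → (x + y) * Δ) matchedInformed≡learned matchedUninformed≡learned ⟩
      (learned + learned) * Δ
    ≡⟨ *-comm (learned + learned) Δ ⟩
      Δ * (learned + learned)
    ∎
    where
    open ≤-Reasoning
    a b : Fin n → ℕ
    a u = 𝟙 (matched (pairing u) ∧ I u)
    b v = 𝟙 (matched (pairing v) ∧ not (I v))
    cutEdge : ∀ u v → 𝟙 (I u ∧ not (I v) ∧ adj G u v) ≤ a u * 𝟙 (adj G u v) + b v * 𝟙 (adj G v u)
    cutEdge u v with I u in Iu | I v in Iv | adj G u v in uv
    ... | false | _     | _     = z≤n
    ... | true  | true  | _     = z≤n
    ... | true  | false | false = z≤n
    ... | true  | false | true rewrite Graph.sym G v u | uv with saturated v Iv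
    ...   | inj₁ matched-v rewrite matched-v = m≤n+m _ _
    ...   | inj₂ nbrs rewrite nbrs u Iu (trans (Graph.sym G v u) uv) = m≤m+n _ _

-- φ ≥ c / v, with the denominator cleared.
ConductanceAtLeast : ∀ {n} → Graph n → ℕ → ℕ → Set
ConductanceAtLeast G c v = ∀ S → Admissible G S → c * vol G S ≤ cut G S * v

∁-halfVol : ∀ {n} (G : Graph n) (S : Subset n) →
  ¬ 2 * vol G S ≤ vol G fullSet → 2 * vol G (∁ S) ≤ vol G fullSet
∁-halfVol G S ¬half = begin
    2 * b   ≡⟨ cong (b +_) (+-identityʳ b) ⟩
    b + b   ≤⟨ +-monoˡ-≤ b b≤a ⟩
    a + b   ≡⟨ vol-∁ G S ⟩
    vol G fullSet ∎
  where
  open ≤-Reasoning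
  a = vol G S
  b = vol G (∁ S)
  a+b<a+a : a + b < a + a
  a+b<a+a = subst₂ _<_ (sym (vol-∁ G S)) (cong (a +_) (+-identityʳ a)) (≰⇒> ¬half)
  b≤a : b ≤ a
  b≤a = <⇒≤ (+-cancelˡ-< a b a a+b<a+a)

module Progress {n} (G : Graph n) {δ Δ c v K : ℕ} (δ≥1 : 1 ≤ δ) (Δ≥1 : 1 ≤ Δ) (v≥1 : 1 ≤ v)
                (δ≤deg : ∀ u → δ ≤ deg G u) (deg≤Δ : ∀ u → deg G u ≤ Δ)
                (φ≥c/v : ConductanceAtLeast G c v) (2Δv≤Kδc : 2 * Δ * v ≤ K * (δ * c))
                (I : Subset n) where
  open RoundProgress G I

  size≤K*learned : ∀ S → Admissible G S → cut G S ≡ cut G I → size S ≤ K * learned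
  size≤K*learned S adm cutS≡cutI = *-cancelˡ-≤ (2 * Δ * v) {{>-nonZero 2Δv>0}} (begin
      2 * Δ * v * size S               ≤⟨ *-monoˡ-≤ (size S) 2Δv≤Kδc ⟩
      K * (δ * c) * size S             ≡⟨ regroup₁ K δ c (size S) ⟩
      K * c * (δ * size S)             ≤⟨ *-monoʳ-≤ (K * c) (δ*size≤vol G δ δ≤deg S) ⟩
      K * c * vol G S                  ≡⟨ *-assoc K c (vol G S) ⟩
      K * (c * vol G S)                ≤⟨ *-monoʳ-≤ K (φ≥c/v S adm) ⟩
      K * (cut G S * v)                ≡⟨ cong (λ x → K * (x * v)) cutS≡cutI ⟩
      K * (cut G I * v)                ≤⟨ *-monoʳ-≤ K (*-monoˡ-≤ v (cut≤Δ*2learned Δ deg≤Δ)) ⟩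
      K * (Δ * (learned + learned) * v) ≡⟨ regroup₂ K Δ learned v ⟩
      2 * Δ * v * (K * learned)        ∎)
    where
    open ≤-Reasoning
    2Δv>0 : 0 < 2 * Δ * v
    2Δv>0 = *-mono-≤ (*-mono-≤ (s≤s (z≤n {1})) Δ≥1) v≥1
    regroup₁ : ∀ K δ c s → K * (δ * c) * s ≡ K * c * (δ * s)
    regroup₁ = solve-∀
    regroup₂ : ∀ K Δ m v → K * (Δ * (m + m) * v) ≡ 2 * Δ * v * (K * m)
    regroup₂ = solve-∀

  vol-pos : ∀ S → 1 ≤ size S → 0 < vol G S
  vol-pos S nonempty = ≤-trans (*-mono-≤ δ≥1 nonempty) (δ*size≤vol G δ δ≤deg S)

  -- Apply the conductance bound to whichever of I and its complement has the smaller volume.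
  progress : 1 ≤ size I → size I < n → size I ≤ K * learned ⊎ n ≤ size I + K * learned
  progress I≢∅ I≢V with 2 * vol G I ≤? vol G fullSet
  ... | yes half = inj₁ (size≤K*learned I (vol-pos I I≢∅ , half) refl)
  ... | no ¬half = inj₂ (subst (_≤ size I + K * learned) (size-∁ I)
                    (+-monoʳ-≤ (size I) (size≤K*learned (∁ I) (vol-pos (∁ I) ∁I≢∅ , ∁-halfVol G I ¬half)
                                                         (sym (cut-∁ G I)))))
    where
    ∁I≢∅ : 1 ≤ size (∁ I)
    ∁I≢∅ = +-cancelˡ-< (size I) 0 (size (∁ I))
             (subst (size I + 0 <_) (sym (size-∁ I)) (subst (_< n) (sym (+-identityʳ (size I))) I≢V))

-- Growth of the informed set

Grows : ℕ → ℕ → (ℕ → ℕ) → Set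
Grows n K a = ∀ t → Σ ℕ λ m → a (suc t) ≡ a t + m × (a t < n → a t ≤ K * m ⊎ n ≤ a t + K * m)

-- y is at least twice x, or n ∸ y is at most half of n ∸ x.
Doubled : ℕ → ℕ → ℕ → Set
Doubled n x y = 2 * x ≤ y ⊎ n + x ≤ 2 * y

Doubled-mono : ∀ {n x y y′} → y ≤ y′ → Doubled n x y → Doubled n x y′
Doubled-mono y≤y′ (inj₁ 2x≤y)   = inj₁ (≤-trans 2x≤y y≤y′)
Doubled-mono y≤y′ (inj₂ n+x≤2y) = inj₂ (≤-trans n+x≤2y (*-monoʳ-≤ 2 y≤y′))

halving : ∀ n x y → n + x ≤ 2 * y → 2 * (n ∸ y) ≤ n ∸ x
halving n x y n+x≤2y = begin
  2 * (n ∸ y)       ≡⟨ *-distribˡ-∸ 2 n y ⟩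
  2 * n ∸ 2 * y     ≤⟨ ∸-monoʳ-≤ (2 * n) n+x≤2y ⟩
  2 * n ∸ (n + x)   ≡⟨ cong (λ z → n + z ∸ (n + x)) (+-identityʳ n) ⟩
  n + n ∸ (n + x)   ≡⟨ [m+n]∸[m+o]≡n∸o n n x ⟩
  n ∸ x             ∎
  where open ≤-Reasoning

module Growth {n K : ℕ} (K≥1 : 1 ≤ K) {a : ℕ → ℕ} (a≤n : ∀ t → a t ≤ n) (grows : Grows n K a) where

  a-step : ∀ t → a t ≤ a (suc t)
  a-step t with grows t
  ... | m , a[t+1]≡a[t]+m , _ = subst (a t ≤_) (sym a[t+1]≡a[t]+m) (m≤m+n _ _)

  a-mono : ∀ i j → a i ≤ a (j + i)
  a-mono i zero    = ≤-refl
  a-mono i (suc j) = ≤-trans (a-mono i j) (a-step (j + i))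

  -- A round that does not yet double a₀ gains at least r / 2K, whichever alternative of Grows holds.
  module Block (i : ℕ) where
    a₀ r : ℕ
    a₀ = a i
    r  = 2 * a₀ ⊓ (n ∸ a₀)

    gain : ∀ x m → a₀ ≤ x → ¬ Doubled n a₀ x → x ≤ K * m ⊎ n ≤ x + K * m → r ≤ 2 * K * m
    gain x m a₀≤x _ (inj₁ x≤Km) =
      ≤-trans (m⊓n≤m _ _) (subst (2 * a₀ ≤_) (sym (*-assoc 2 K m)) (*-monoʳ-≤ 2 (≤-trans a₀≤x x≤Km)))
    gain x m a₀≤x ¬dbl (inj₂ n≤x+Km) =
      ≤-trans (m⊓n≤n _ _) (m≤n+o⇒m∸n≤o n a₀ (<⇒≤ (+-cancelˡ-< n n (a₀ + 2 * K * m) (begin-strict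
        n + n                     ≤⟨ +-mono-≤ n≤x+Km n≤x+Km ⟩
        x + K * m + (x + K * m)   ≡⟨ regroup x (K * m) ⟩
        2 * x + 2 * (K * m)       <⟨ +-monoˡ-< (2 * (K * m)) (≰⇒> (λ n+a₀≤2x → ¬dbl (inj₂ n+a₀≤2x))) ⟩
        n + a₀ + 2 * (K * m)      ≡⟨ reassoc n a₀ K m ⟩
        n + (a₀ + 2 * K * m)      ∎))))
      where
      open ≤-Reasoning
      regroup : ∀ x y → x + y + (x + y) ≡ 2 * x + 2 * y
      regroup = solve-∀
      reassoc : ∀ n a K m → n + a + 2 * (K * m) ≡ n + (a + 2 * K * m)
      reassoc = solve-∀

    accumulate : ∀ j → Doubled n a₀ (a (j + i)) ⊎ j * r + 2 * K * a₀ ≤ 2 * K * a (j + i)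
    accumulate zero = inj₂ ≤-refl
    accumulate (suc j) with accumulate j
    ... | inj₁ dbl = inj₁ (Doubled-mono {n} (a-step (j + i)) dbl)
    ... | inj₂ gained with (2 * a₀ ≤? a (j + i)) ⊎-dec (n + a₀ ≤? 2 * a (j + i))
    ...   | yes dbl = inj₁ (Doubled-mono {n} (a-step (j + i)) dbl)
    ...   | no ¬dbl with grows (j + i)
    ...     | m , a[t+1]≡a[t]+m , prog =
      inj₂ (subst (λ y → suc j * r + 2 * K * a₀ ≤ 2 * K * y) (sym a[t+1]≡a[t]+m) (begin
        suc j * r + 2 * K * a₀        ≡⟨ +-assoc r (j * r) (2 * K * a₀) ⟩
        r + (j * r + 2 * K * a₀)      ≤⟨ +-mono-≤ (gain x m (a-mono i j) ¬dbl (prog x<n)) gained ⟩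
        2 * K * m + 2 * K * x         ≡⟨ +-comm (2 * K * m) (2 * K * x) ⟩
        2 * K * x + 2 * K * m         ≡⟨ sym (*-distribˡ-+ (2 * K) x m) ⟩
        2 * K * (x + m)               ∎))
      where
      open ≤-Reasoning
      x = a (j + i)
      x<n : x < n
      x<n with x <? n
      ... | yes x<n = x<n
      ... | no  x≮n = ⊥-elim (¬dbl (inj₂ (subst (n + a₀ ≤_) (cong (x +_) (sym (+-identityʳ x)))
                                             (+-mono-≤ (≮⇒≥ x≮n) (a-mono i j)))))

    block : Doubled n a₀ (a (K + i))
    block with accumulate K
    ... | inj₁ dbl = dbl
    ... | inj₂ gained = finish (*-cancelˡ-≤ K {{>-nonZero K≥1}} (subst₂ _≤_ (factorˡ K r a₀) (factorʳ K y) gained))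
      where
      y = a (K + i)
      factorˡ : ∀ K r a → K * r + 2 * K * a ≡ K * (r + 2 * a)
      factorˡ = solve-∀
      factorʳ : ∀ K y → 2 * K * y ≡ K * (2 * y)
      factorʳ = solve-∀
      twice : ∀ z → z + z ≡ 2 * z
      twice = solve-∀
      regroup : ∀ a d → a + d + a ≡ d + 2 * a
      regroup = solve-∀
      finish : r + 2 * a₀ ≤ 2 * y → Doubled n a₀ y
      finish h with ⊓-sel (2 * a₀) (n ∸ a₀)
      ... | inj₁ r≡2a₀ =
        inj₁ (*-cancelˡ-≤ 2 (subst (_≤ 2 * y) (trans (cong (_+ 2 * a₀) r≡2a₀) (twice (2 * a₀))) h))
      ... | inj₂ r≡n∸a₀ = inj₂ (begin
        n + a₀                ≤⟨ +-monoˡ-≤ a₀ (m≤n+m∸n n a₀) ⟩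
        a₀ + (n ∸ a₀) + a₀    ≡⟨ regroup a₀ (n ∸ a₀) ⟩
        n ∸ a₀ + 2 * a₀       ≡⟨ cong (_+ 2 * a₀) (sym r≡n∸a₀) ⟩
        r + 2 * a₀            ≤⟨ h ⟩
        2 * y                 ∎)
        where open ≤-Reasoning

  blocks : ℕ → ℕ
  blocks i = a (K * i)

  blocks-doubled : ∀ i → Doubled n (blocks i) (blocks (suc i))
  blocks-doubled i = subst (λ t → Doubled n (blocks i) (a t)) (sym (*-suc K i)) (Block.block (K * i))

  blocks-mono : ∀ i → blocks i ≤ blocks (suc i)
  blocks-mono i = subst (λ t → blocks i ≤ a t) (sym (*-suc K i)) (a-mono (K * i) K)

  -- After i blocks, the informed count has doubled d times and the uninformed count halved h times.
  Split : ℕ → Set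
  Split i = Σ ℕ λ d → Σ ℕ λ h → d + h ≡ i × 2 ^ d ≤ blocks i × (n ∸ blocks i) * 2 ^ h < n

  split : 1 ≤ a 0 → ∀ i → Split i
  split a₀≥1 zero = 0 , 0 , refl , a₀≥1′ , subst (_< n) (sym (*-identityʳ _)) (∸-monoʳ-< a₀≥1′ (a≤n _))
    where
    a₀≥1′ : 1 ≤ blocks 0
    a₀≥1′ = subst (λ t → 1 ≤ a t) (sym (*-zeroʳ K)) a₀≥1
  split a₀≥1 (suc i) with split a₀≥1 i | blocks-doubled i
  ... | d , h , d+h≡i , 2^d≤x , u*2^h<n | inj₁ 2x≤y =
    suc d , h , cong suc d+h≡i , ≤-trans (*-monoʳ-≤ 2 2^d≤x) 2x≤y ,
    ≤-<-trans (*-monoˡ-≤ (2 ^ h) (∸-monoʳ-≤ n (blocks-mono i))) u*2^h<n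
  ... | d , h , d+h≡i , 2^d≤x , u*2^h<n | inj₂ n+x≤2y =
    d , suc h , trans (+-suc d h) (cong suc d+h≡i) , ≤-trans 2^d≤x (blocks-mono i) ,
    ≤-<-trans (≤-reflexive (regroup (n ∸ blocks (suc i)) (2 ^ h)))
              (≤-<-trans (*-monoˡ-≤ (2 ^ h) (halving n (blocks i) (blocks (suc i)) n+x≤2y)) u*2^h<n)
    where
    regroup : ∀ u p → u * (2 * p) ≡ 2 * u * p
    regroup = solve-∀

  saturates : 1 ≤ a 0 → ∀ L → n ≤ 2 ^ L → a (K * (L + L)) ≡ n
  saturates a₀≥1 L n≤2^L with split a₀≥1 (L + L)
  ... | d , h , d+h≡2L , 2^d≤x , u*2^h<n with L ≤? d
  ...   | yes L≤d = ≤-antisym (a≤n _) (≤-trans n≤2^L (≤-trans (^-monoʳ-≤ 2 L≤d) 2^d≤x))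
  ...   | no  L≰d = ≤-antisym (a≤n _) (m∸n≡0⇒m≤n (u≡0 (n ∸ blocks (L + L)) u*2^h<n))
    where
    L≤h : L ≤ h
    L≤h = +-cancelˡ-≤ d L h (≤-trans (+-monoˡ-≤ L (<⇒≤ (≰⇒> L≰d))) (≤-reflexive (sym d+h≡2L)))
    u≡0 : ∀ u → u * 2 ^ h < n → u ≡ 0
    u≡0 zero    _ = refl
    u≡0 (suc u) u*2^h<n = ⊥-elim (<⇒≱ u*2^h<n
      (≤-trans n≤2^L (≤-trans (^-monoʳ-≤ 2 L≤h) (m≤m+n (2 ^ h) (u * 2 ^ h)))))

n≤2^⌈log2⌉ : ∀ n (rec : Acc _<_ n) → n ≤ 2 ^ ⌈log2⌉ n rec
n≤2^⌈log2⌉ zero                _        = z≤n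
n≤2^⌈log2⌉ (suc zero)          _        = ≤-refl
n≤2^⌈log2⌉ (suc (suc n)) (acc rs) = ≤-trans 2+n≤2*[1+⌈n/2⌉] (*-monoʳ-≤ 2 (n≤2^⌈log2⌉ (suc ⌈ n /2⌉) _))
  where
  double : ∀ x → suc (suc (x + x)) ≡ 2 * suc x
  double = solve-∀
  2+n≤2*[1+⌈n/2⌉] : suc (suc n) ≤ 2 * suc ⌈ n /2⌉
  2+n≤2*[1+⌈n/2⌉] = ≤-trans
    (s≤s (s≤s (≤-trans (≤-reflexive (sym (⌊n/2⌋+⌈n/2⌉≡n n))) (+-monoˡ-≤ _ (⌊n/2⌋≤⌈n/2⌉ n)))))
    (≤-reflexive (double ⌈ n /2⌉))

n≤2^⌈log₂n⌉ : ∀ n → n ≤ 2 ^ ⌈log₂ n ⌉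
n≤2^⌈log₂n⌉ n = n≤2^⌈log2⌉ n _

roundUp : ∀ m d → 1 ≤ d → Σ ℕ λ K → 1 ≤ K × m ≤ K * d × K * d ≤ m + d
roundUp m d d≥1 = m / d + 1 , subst (1 ≤_) (+-comm 1 (m / d)) (s≤s z≤n) , m≤K*d , K*d≤m+d
  where
  instance _ = >-nonZero d≥1
  distrib : ∀ q d → d + q * d ≡ (q + 1) * d
  distrib = solve-∀
  m≤K*d : m ≤ (m / d + 1) * d
  m≤K*d = <⇒≤ (begin-strict
    m                 ≡⟨ m≡m%n+[m/n]*n m d ⟩
    m % d + m / d * d <⟨ +-monoˡ-< (m / d * d) (m%n<n m d) ⟩
    d + m / d * d     ≡⟨ distrib (m / d) d ⟩
    (m / d + 1) * d   ∎)
    where open ≤-Reasoning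
  K*d≤m+d : (m / d + 1) * d ≤ m + d
  K*d≤m+d = subst (_≤ m + d) (trans (+-comm _ d) (distrib (m / d) d)) (+-monoˡ-≤ d (m/n*n≤m m d))

module GreedySchedule {n} (G : Graph n) where

  next : Subset n → Subset n
  next I = stepRound (GreedyRound.round G I) I

  schedule : ∀ T → Subset n → Vec (Round G) T
  schedule zero    I = []
  schedule (suc T) I = GreedyRound.round G I ∷ schedule T (next I)

  informedAfter : ℕ → Subset n → Subset n
  informedAfter zero    I = I
  informedAfter (suc t) I = next (informedAfter t I)

  informedAfter-suc : ∀ t I → informedAfter t (next I) ≡ next (informedAfter t I)
  informedAfter-suc zero    I = refl
  informedAfter-suc (suc t) I = cong next (informedAfter-suc t I)

  runRounds-schedule : ∀ T I → runRounds (schedule T I) I ≡ informedAfter T I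
  runRounds-schedule zero    I = refl
  runRounds-schedule (suc T) I = trans (runRounds-schedule T (next I)) (informedAfter-suc T I)

-- 2 ⌈log₂ n⌉ blocks of K = ⌈2Δ v / (δ c)⌉ rounds; the 6 absorbs K δ c ≤ 2Δ v + δ c ≤ 3Δ v.
greedy-spreads : ∀ {n} (G : Graph n) {δ Δ c v} → 1 ≤ δ → MinDegree G δ → MaxDegree G Δ →
  1 ≤ c → c ≤ v → ConductanceAtLeast G c v →
  (s : Fin n) → Σ ℕ λ T → SolvableIn G s T × T * δ * c ≤ 6 * Δ * ⌈log₂ n ⌉ * v
greedy-spreads {n} G {δ} {Δ} {c} {v} δ≥1 (δ≤deg , _) (deg≤Δ , _) c≥1 c≤v φ≥c/v s
  with roundUp (2 * Δ * v) (δ * c) (*-mono-≤ δ≥1 c≥1)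
... | K , K≥1 , 2Δv≤Kδc , Kδc≤2Δv+δc = T , (schedule T I₀ , informsAll) , T-bound
  where
  open GreedySchedule G
  L = ⌈log₂ n ⌉
  T = K * (L + L)
  I₀ = initial s
  δ≤Δ = ≤-trans (δ≤deg s) (deg≤Δ s)

  a : ℕ → ℕ
  a t = size (informedAfter t I₀)

  a≥1 : ∀ t → 1 ≤ a t
  a≥1 zero    = ≤-reflexive (sym (size-initial s))
  a≥1 (suc t) = ≤-trans (a≥1 t) (subst (a t ≤_) (sym (RoundProgress.size-stepRound G (informedAfter t I₀))) (m≤m+n _ _))

  grows : Grows n K a
  grows t = RoundProgress.learned G I , RoundProgress.size-stepRound G I ,
            Progress.progress G {δ} {Δ} {c} {v} {K} δ≥1 (≤-trans δ≥1 δ≤Δ) (≤-trans c≥1 c≤v) δ≤deg deg≤Δ φ≥c/v 2Δv≤Kδc I (a≥1 t)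
    where I = informedAfter t I₀

  informsAll : ∀ u → runRounds (schedule T I₀) I₀ u ≡ true
  informsAll u = trans (cong (λ I → I u) (runRounds-schedule T I₀))
    (size≡n⇒full (informedAfter T I₀)
      (Growth.saturates K≥1 (λ t → size≤n _) grows (a≥1 0) L (n≤2^⌈log₂n⌉ n)) u)

  T-bound : T * δ * c ≤ 6 * Δ * L * v
  T-bound = begin
    T * δ * c                    ≡⟨ regroup K L δ c ⟩
    (L + L) * (K * (δ * c))      ≤⟨ *-monoʳ-≤ (L + L) Kδc≤2Δv+δc ⟩
    (L + L) * (2 * Δ * v + δ * c) ≤⟨ *-monoʳ-≤ (L + L) (+-monoʳ-≤ (2 * Δ * v) (*-mono-≤ δ≤Δ c≤v)) ⟩
    (L + L) * (2 * Δ * v + Δ * v) ≡⟨ collect L Δ v ⟩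
    6 * Δ * L * v                ∎
    where
    open ≤-Reasoning
    regroup : ∀ K L δ c → K * (L + L) * δ * c ≡ (L + L) * (K * (δ * c))
    regroup = solve-∀
    collect : ∀ L Δ v → (L + L) * (2 * Δ * v + Δ * v) ≡ 6 * Δ * L * v
    collect = solve-∀

-- Rational conductances

ℕtoℚ≃ : ∀ a → toℚᵘ (ℕtoℚ a) ℚᵘ.≃ ℚᵘ.mkℚᵘ (ℤ.+ a) 0
ℕtoℚ≃ a = ℚP.toℚᵘ-fromℚᵘ (ℚᵘ.mkℚᵘ (ℤ.+ a) 0)

ℕtoℚ-* : ∀ a b → ℕtoℚ (a * b) ≡ ℕtoℚ a *ℚ ℕtoℚ b
ℕtoℚ-* a b = ℚP.toℚᵘ-injective (begin
  toℚᵘ (ℕtoℚ (a * b))                             ≈⟨ ℕtoℚ≃ (a * b) ⟩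
  ℚᵘ.mkℚᵘ (ℤ.+ (a * b)) 0                               ≈⟨ ℚᵘ.*≡* (cong (ℤ._* ℤ.+ 1) (ℤP.pos-* a b)) ⟩
  ℚᵘ.mkℚᵘ (ℤ.+ a) 0 ℚᵘ.* ℚᵘ.mkℚᵘ (ℤ.+ b) 0                ≈⟨ ℚᵘP.*-cong (ℚᵘP.≃-sym (ℕtoℚ≃ a)) (ℚᵘP.≃-sym (ℕtoℚ≃ b)) ⟩
  toℚᵘ (ℕtoℚ a) ℚᵘ.* toℚᵘ (ℕtoℚ b)              ≈⟨ ℚᵘP.≃-sym (ℚP.toℚᵘ-homo-* (ℕtoℚ a) (ℕtoℚ b)) ⟩
  toℚᵘ (ℕtoℚ a *ℚ ℕtoℚ b)                         ∎)
  where open ℚᵘP.≃-Reasoning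

ℕtoℚ-mono-≤ : ∀ {a b} → a ≤ b → ℕtoℚ a ≤ℚ ℕtoℚ b
ℕtoℚ-mono-≤ {a} {b} a≤b = ℚP.toℚᵘ-cancel-≤
  (ℚᵘP.≤-respˡ-≃ (ℚᵘP.≃-sym (ℕtoℚ≃ a)) (ℚᵘP.≤-respʳ-≃ (ℚᵘP.≃-sym (ℕtoℚ≃ b))
    (ℚᵘ.*≤* (subst₂ ℤ._≤_ (sym (ℤP.*-identityʳ (ℤ.+ a))) (sym (ℤP.*-identityʳ (ℤ.+ b))) (ℤ.+≤+ a≤b)))))

ℕtoℚ-cancel-≤ : ∀ {a b} → ℕtoℚ a ≤ℚ ℕtoℚ b → a ≤ b
ℕtoℚ-cancel-≤ {a} {b} a≤b with ℚᵘP.≤-respˡ-≃ (ℕtoℚ≃ a) (ℚᵘP.≤-respʳ-≃ (ℕtoℚ≃ b) (ℚP.toℚᵘ-mono-≤ a≤b))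
... | ℚᵘ.*≤* a*1≤b*1 = ℤP.drop‿+≤+ (subst₂ ℤ._≤_ (ℤP.*-identityʳ (ℤ.+ a)) (ℤP.*-identityʳ (ℤ.+ b)) a*1≤b*1)

ℕtoℚ-pos : ∀ {v} → 1 ≤ v → Positive (ℕtoℚ v)
ℕtoℚ-pos {suc v} _ = ℚP.normalize-pos (suc v) 1

ratio : ∀ c v → 1 ≤ v → Σ ℚ λ φ → φ *ℚ ℕtoℚ v ≡ ℕtoℚ c
ratio c v v≥1 = ℕtoℚ c *ℚ 1/ ℕtoℚ v ,
  trans (ℚP.*-assoc (ℕtoℚ c) _ _) (trans (cong (ℕtoℚ c *ℚ_) (ℚP.*-inverseˡ (ℕtoℚ v))) (ℚP.*-identityʳ _))
  where instance _ = ℚP.pos⇒nonZero (ℕtoℚ v) {{ℕtoℚ-pos v≥1}}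

-- For φ = c / v, comparisons of naturals scaled by φ are comparisons of cross products in ℕ.
module Ratio {c v : ℕ} {φ : ℚ} (v≥1 : 1 ≤ v) (φv≡c : φ *ℚ ℕtoℚ v ≡ ℕtoℚ c) where
  private instance v>0 = ℕtoℚ-pos v≥1

  *φ*v : ∀ a → ℕtoℚ a *ℚ φ *ℚ ℕtoℚ v ≡ ℕtoℚ (a * c)
  *φ*v a = trans (ℚP.*-assoc (ℕtoℚ a) φ _) (trans (cong (ℕtoℚ a *ℚ_) φv≡c) (sym (ℕtoℚ-* a c)))

  *φ≤⇒ : ∀ a b → ℕtoℚ a *ℚ φ ≤ℚ ℕtoℚ b → a * c ≤ b * v
  *φ≤⇒ a b ≤b = ℕtoℚ-cancel-≤ (subst₂ _≤ℚ_ (*φ*v a) (sym (ℕtoℚ-* b v)) (ℚP.*-monoʳ-≤-nonNeg (ℕtoℚ v) {{ℚP.pos⇒nonNeg (ℕtoℚ v)}} ≤b))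

  *φ≤⇐ : ∀ a b → a * c ≤ b * v → ℕtoℚ a *ℚ φ ≤ℚ ℕtoℚ b
  *φ≤⇐ a b ac≤bv = ℚP.*-cancelʳ-≤-pos (ℕtoℚ v) (subst₂ _≤ℚ_ (sym (*φ*v a)) (ℕtoℚ-* b v) (ℕtoℚ-mono-≤ ac≤bv))

  ≤*φ⇐ : ∀ a b → b * v ≤ a * c → ℕtoℚ b ≤ℚ ℕtoℚ a *ℚ φ
  ≤*φ⇐ a b bv≤ac = ℚP.*-cancelʳ-≤-pos (ℕtoℚ v) (subst₂ _≤ℚ_ (ℕtoℚ-* b v) (sym (*φ*v a)) (ℕtoℚ-mono-≤ bv≤ac))

connected⇒cut-pos : ∀ {n} (G : Graph n) → Connected G → ∀ S → Admissible G S → 1 ≤ cut G S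
connected⇒cut-pos G conn S (vol>0 , half) =
  walk⇒cut-pos G S (conn (proj₁ inS) (proj₁ outS)) (proj₂ inS) (not-true (proj₂ outS))
  where
  ∁vol>0 : 0 < vol G (∁ S)
  ∁vol>0 = <-≤-trans vol>0 (+-cancelˡ-≤ (vol G S) _ _
    (subst₂ _≤_ (cong (vol G S +_) (+-identityʳ _)) (sym (vol-∁ G S)) half))
  inS = vol-pos⇒∃ G S vol>0
  outS = vol-pos⇒∃ G (∁ S) ∁vol>0
  not-true : ∀ {b} → not b ≡ true → b ≡ false
  not-true {false} _ = refl

upper-bound : ∀ (n : ℕ) (G : Graph n) (δ Δ : ℕ) (φ : ℚ) → Connected G → 1 ≤ δ →
  MinDegree G δ → MaxDegree G Δ → IsConductance G φ →
  ∀ (s : Fin n) → Σ ℕ λ T → SolvableIn G s T ×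
    (ℕtoℚ T *ℚ ℕtoℚ δ *ℚ φ ≤ℚ ℕtoℚ 6 *ℚ ℕtoℚ Δ *ℚ ℕtoℚ ⌈log₂ n ⌉)
upper-bound n G δ Δ φ conn δ≥1 minDeg maxDeg ((S₀ , adm₀ , φv≡c) , φ-min) s =
  T , solves , subst₂ _≤ℚ_ (cong (_*ℚ φ) (ℕtoℚ-* T δ)) (trans (ℕtoℚ-* (6 * Δ) _) (cong (_*ℚ _) (ℕtoℚ-* 6 Δ)))
                           (*φ≤⇐ (T * δ) (6 * Δ * ⌈log₂ n ⌉) T-bound)
  where
  open Ratio {cut G S₀} {vol G S₀} {φ} (proj₁ adm₀) φv≡c
  φ≥c/v : ConductanceAtLeast G (cut G S₀) (vol G S₀)
  φ≥c/v S adm = subst (_≤ cut G S * vol G S₀) (*-comm (vol G S) _)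
    (*φ≤⇒ (vol G S) (cut G S) (subst (_≤ℚ _) (ℚP.*-comm φ _) (φ-min S adm)))
  spread = greedy-spreads G δ≥1 minDeg maxDeg (connected⇒cut-pos G conn S₀ adm₀) (cut≤vol G S₀) φ≥c/v s
  T = proj₁ spread
  solves = proj₁ (proj₂ spread)
  T-bound = proj₂ (proj₂ spread)

allSubsets : (n : ℕ) → List (Subset n)
allSubsets zero    = (λ ()) ∷ []
allSubsets (suc n) = map (cons true) (allSubsets n) ++ map (cons false) (allSubsets n)
  where
  cons : Bool → Subset n → Subset (suc n)
  cons b S zero    = b
  cons b S (suc i) = S i

allSubsets-complete : ∀ {n} (S : Subset n) → ∃ λ S′ → S′ ∈ allSubsets n × S ≗ S′
allSubsets-complete {zero}  S = (λ ()) , here refl , λ ()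
allSubsets-complete {suc n} S with allSubsets-complete (λ i → S (suc i)) | S zero in S0
... | S′ , S′∈ , S≗S′ | true  = _ , ∈-++⁺ˡ (∈-map⁺ _ S′∈) , λ { zero → S0 ; (suc i) → S≗S′ i }
... | S′ , S′∈ , S≗S′ | false = _ , ∈-++⁺ʳ (map _ (allSubsets n)) (∈-map⁺ _ S′∈) , λ { zero → S0 ; (suc i) → S≗S′ i }

module _ {n} (G : Graph n) where

  vol-cong : ∀ {S S′ : Subset n} → S ≗ S′ → vol G S ≡ vol G S′
  vol-cong S≗S′ = sumFin-cong (λ u → cong (λ b → if b then deg G u else 0) (S≗S′ u))

  cut-cong : ∀ {S S′ : Subset n} → S ≗ S′ → cut G S ≡ cut G S′
  cut-cong S≗S′ = sumFin-cong (λ u → sumFin-cong (λ v →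
    cong₂ (λ a b → 𝟙 (a ∧ not b ∧ adj G u v)) (S≗S′ u) (S≗S′ v)))

  admissible? : ∀ S → Dec (Admissible G S)
  admissible? S = (0 <? vol G S) ×-dec (2 * vol G S ≤? vol G fullSet)

  -- cut A / vol A ≤ cut B / vol B, cross-multiplied.
  _≼_ : Subset n → Subset n → Set
  A ≼ B = cut G A * vol G B ≤ cut G B * vol G A

  ≼-trans : ∀ {A B C} → 0 < vol G B → A ≼ B → B ≼ C → A ≼ C
  ≼-trans {A} {B} {C} vB>0 A≼B B≼C = *-cancelʳ-≤ _ _ (vol G B) {{>-nonZero vB>0}} (begin
      cut G A * vol G C * vol G B   ≡⟨ swap₂₃ (cut G A) (vol G C) (vol G B) ⟩
      cut G A * vol G B * vol G C   ≤⟨ *-monoˡ-≤ (vol G C) A≼B ⟩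
      cut G B * vol G A * vol G C   ≡⟨ rotate (cut G B) (vol G A) (vol G C) ⟩
      vol G A * (cut G B * vol G C) ≤⟨ *-monoʳ-≤ (vol G A) B≼C ⟩
      vol G A * (cut G C * vol G B) ≡⟨ unrotate (vol G A) (cut G C) (vol G B) ⟩
      cut G C * vol G A * vol G B   ∎)
    where
    open ≤-Reasoning
    swap₂₃ : ∀ x y z → x * y * z ≡ x * z * y
    swap₂₃ = solve-∀
    rotate : ∀ x y z → x * y * z ≡ y * (x * z)
    rotate = solve-∀
    unrotate : ∀ x y z → x * (y * z) ≡ y * x * z
    unrotate = solve-∀

  minimalAmong : (S₁ : Subset n) → Admissible G S₁ → (Ss : List (Subset n)) →
    Σ (Subset n) λ B → Admissible G B × (∀ S → S ∈ Ss → Admissible G S → B ≼ S)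
  minimalAmong S₁ adm₁ [] = S₁ , adm₁ , λ _ ()
  minimalAmong S₁ adm₁ (S ∷ Ss) with minimalAmong S₁ adm₁ Ss
  ... | B , admB , B≼Ss with admissible? S
  ...   | no ¬admS = B , admB , λ { S′ (here refl) admS → ⊥-elim (¬admS admS) ; S′ (there S′∈) → B≼Ss S′ S′∈ }
  ...   | yes admS with cut G S * vol G B ≤? cut G B * vol G S
  ...     | yes S≼B = S , admS , λ { S′ (here refl) _ → ≤-refl
                                   ; S′ (there S′∈) admS′ → ≼-trans {S} {B} {S′} (proj₁ admB) S≼B (B≼Ss S′ S′∈ admS′) }
  ...     | no  S⋠B = B , admB , λ { S′ (here refl) _ → <⇒≤ (≰⇒> S⋠B) ; S′ (there S′∈) → B≼Ss S′ S′∈ }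

  minimal : (S₁ : Subset n) → Admissible G S₁ →
    Σ (Subset n) λ S₀ → Admissible G S₀ × (∀ S → Admissible G S → S₀ ≼ S)
  minimal S₁ adm₁ with minimalAmong S₁ adm₁ (allSubsets n)
  ... | B , admB , B≼all = B , admB , B≼
    where
    B≼ : ∀ S → Admissible G S → B ≼ S
    B≼ S (vol>0 , half) with allSubsets-complete S
    ... | S′ , S′∈ , S≗S′ = subst₂ (λ x y → cut G B * x ≤ y * vol G B) (sym (vol-cong S≗S′)) (sym (cut-cong S≗S′))
      (B≼all S′ S′∈ (subst (0 <_) (vol-cong S≗S′) vol>0 , subst (λ z → 2 * z ≤ vol G fullSet) (vol-cong S≗S′) half))

  conductance-exists : (S₁ : Subset n) → Admissible G S₁ → Σ ℚ (IsConductance G)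
  conductance-exists S₁ adm₁ = φ , (S₀ , adm₀ , φv≡c) , φ-min
    where
    S₀  = proj₁ (minimal S₁ adm₁)
    adm₀ = proj₁ (proj₂ (minimal S₁ adm₁))
    φ = proj₁ (ratio (cut G S₀) (vol G S₀) (proj₁ adm₀))
    φv≡c : φ *ℚ ℕtoℚ (vol G S₀) ≡ ℕtoℚ (cut G S₀)
    φv≡c = proj₂ (ratio (cut G S₀) (vol G S₀) (proj₁ adm₀))
    open Ratio {cut G S₀} {vol G S₀} {φ} (proj₁ adm₀) φv≡c
    φ-min : ∀ S → Admissible G S → φ *ℚ ℕtoℚ (vol G S) ≤ℚ ℕtoℚ (cut G S)
    φ-min S adm = subst (_≤ℚ ℕtoℚ (cut G S)) (ℚP.*-comm (ℕtoℚ (vol G S)) φ)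
      (*φ≤⇐ (vol G S) (cut G S)
        (subst (_≤ cut G S * vol G S₀) (*-comm (cut G S₀) (vol G S)) (proj₂ (proj₂ (minimal S₁ adm₁)) S adm)))

-- The lower bound on complete bipartite graphs

am-gm : ∀ p q → 4 * (p * q) ≤ (p + q) * (p + q)
am-gm p q with ≤-total p q
... | inj₁ p≤q with m≤n⇒∃[o]m+o≡n p≤q
...   | d , refl = subst₂ _≤_ (lhs p d) (rhs p d) (m≤m+n (4 * (p * p) + 4 * (p * d)) (d * d))
  where
  lhs : ∀ p d → 4 * (p * p) + 4 * (p * d) ≡ 4 * (p * (p + d))
  lhs = solve-∀
  rhs : ∀ p d → 4 * (p * p) + 4 * (p * d) + d * d ≡ (p + (p + d)) * (p + (p + d))
  rhs = solve-∀
am-gm p q | inj₂ q≤p with m≤n⇒∃[o]m+o≡n q≤p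
...   | d , refl = subst₂ _≤_ (lhs q d) (rhs q d) (m≤m+n (4 * (q * q) + 4 * (q * d)) (d * d))
  where
  lhs : ∀ q d → 4 * (q * q) + 4 * (q * d) ≡ 4 * ((q + d) * q)
  lhs = solve-∀
  rhs : ∀ q d → 4 * (q * q) + 4 * (q * d) + d * d ≡ (q + d + q) * (q + d + q)
  rhs = solve-∀

square-cancel-≤ : ∀ {p q} → p * p ≤ q * q → p ≤ q
square-cancel-≤ {p} {q} p²≤q² with p ≤? q
... | yes p≤q = p≤q
... | no  p≰q = ⊥-elim (<⇒≱ (*-mono-< (≰⇒> p≰q) (≰⇒> p≰q)) p²≤q²)

-- (xy)² ≤ (xy′)(yx′) ≤ ((xy′ + yx′) / 2)².
2xy≤xy′+yx′ : ∀ x y x′ y′ → x * y ≤ x′ * y′ → 2 * (x * y) ≤ x * y′ + y * x′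
2xy≤xy′+yx′ x y x′ y′ xy≤x′y′ = square-cancel-≤ (begin
    2 * (x * y) * (2 * (x * y))           ≡⟨ square x y ⟩
    4 * (x * y * (x * y))                 ≤⟨ *-monoʳ-≤ 4 (*-monoʳ-≤ (x * y) xy≤x′y′) ⟩
    4 * (x * y * (x′ * y′))               ≡⟨ rearrange x y x′ y′ ⟩
    4 * (x * y′ * (y * x′))               ≤⟨ am-gm (x * y′) (y * x′) ⟩
    (x * y′ + y * x′) * (x * y′ + y * x′) ∎)
  where
  open ≤-Reasoning
  square : ∀ x y → 2 * (x * y) * (2 * (x * y)) ≡ 4 * (x * y * (x * y))
  square = solve-∀
  rearrange : ∀ x y x′ y′ → 4 * (x * y * (x′ * y′)) ≡ 4 * (x * y′ * (y * x′))
  rearrange = solve-∀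

-- In K_{a,b}, a set with x of the a left and y of the b right vertices has volume x b + y a and
-- cut x y′ + y x′.
bipartite-vol≤2cut : ∀ x x′ y y′ → 2 * (x * (y + y′) + y * (x + x′)) ≤ (x + x′) * (y + y′) + (y + y′) * (x + x′) →
  x * (y + y′) + y * (x + x′) ≤ 2 * (x * y′ + y * x′)
bipartite-vol≤2cut x x′ y y′ half =
  subst₂ _≤_ (volume x x′ y y′) (cut² x x′ y y′) (+-monoˡ-≤ (x * y′ + y * x′) (2xy≤xy′+yx′ x y x′ y′ xy≤x′y′))
  where
  expandˡ : ∀ x x′ y y′ → 2 * (x * (y + y′) + y * (x + x′)) ≡ 2 * (x * y) + (2 * (x * y) + 2 * (x * y′ + y * x′))
  expandˡ = solve-∀
  expandʳ : ∀ x x′ y y′ → (x + x′) * (y + y′) + (y + y′) * (x + x′) ≡ 2 * (x * y) + (2 * (x′ * y′) + 2 * (x * y′ + y * x′))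
  expandʳ = solve-∀
  xy≤x′y′ : x * y ≤ x′ * y′
  xy≤x′y′ = *-cancelˡ-≤ 2 (+-cancelʳ-≤ (2 * (x * y′ + y * x′)) _ _
              (+-cancelˡ-≤ (2 * (x * y)) _ _ (subst₂ _≤_ (expandˡ x x′ y y′) (expandʳ x x′ y y′) half)))
  volume : ∀ x x′ y y′ → 2 * (x * y) + (x * y′ + y * x′) ≡ x * (y + y′) + y * (x + x′)
  volume = solve-∀
  cut² : ∀ x x′ y y′ → x * y′ + y * x′ + (x * y′ + y * x′) ≡ 2 * (x * y′ + y * x′)
  cut² = solve-∀

module CompleteBipartite (a b : ℕ) where

  side : Fin (a + b) → Bool
  side x = is-just (isInj₁ (splitAt a x))

  side-↑ˡ : ∀ i → side (i ↑ˡ b) ≡ true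
  side-↑ˡ i = cong (λ x → is-just (isInj₁ x)) (splitAt-↑ˡ a i b)

  side-↑ʳ : ∀ j → side (a ↑ʳ j) ≡ false
  side-↑ʳ j = cong (λ x → is-just (isInj₁ x)) (splitAt-↑ʳ a b j)

  xor-comm : ∀ p q → p xor q ≡ q xor p
  xor-comm true  true  = refl
  xor-comm true  false = refl
  xor-comm false true  = refl
  xor-comm false false = refl

  xor-self : ∀ p → p xor p ≡ false
  xor-self true  = refl
  xor-self false = refl

  K : Graph (a + b)
  K = record { adj    = λ u v → side u xor side v
             ; sym    = λ u v → xor-comm (side u) (side v)
             ; irrefl = λ u → xor-self (side u) }

  sumFin-sides : ∀ (f : Bool → Fin (a + b) → ℕ) →
    sumFin (λ u → f (side u) u) ≡ sumFin (λ i → f true (i ↑ˡ b)) + sumFin (λ j → f false (a ↑ʳ j))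
  sumFin-sides f = trans (sumFin-↑ a b _)
    (cong₂ _+_ (sumFin-cong (λ i → cong (λ s → f s (i ↑ˡ b)) (side-↑ˡ i)))
               (sumFin-cong (λ j → cong (λ s → f s (a ↑ʳ j)) (side-↑ʳ j))))

  size-side : size side ≡ a
  size-side = trans (sumFin-sides (λ s _ → 𝟙 s))
    (trans (cong₂ _+_ (sumFin-one {a}) (sumFin-zero {b})) (+-identityʳ a))

  size-∁side : size (∁ side) ≡ b
  size-∁side = trans (sumFin-sides (λ s _ → 𝟙 (not s))) (cong₂ _+_ (sumFin-zero {a}) (sumFin-one {b}))

  degreeOn : Bool → ℕ
  degreeOn true  = b
  degreeOn false = a

  deg-side : ∀ u → deg K u ≡ degreeOn (side u)
  deg-side u = trans (sumFin-sides (λ s _ → 𝟙 (side u xor s))) (count (side u))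
    where
    count : ∀ s → sumFin {a} (λ _ → 𝟙 (s xor true)) + sumFin {b} (λ _ → 𝟙 (s xor false)) ≡ degreeOn s
    count true  = trans (cong (_+ sumFin {b} (λ _ → 1)) (sumFin-zero {a})) (sumFin-one {b})
    count false = trans (cong₂ _+_ (sumFin-one {a}) (sumFin-zero {b})) (+-identityʳ a)

  vol-full : vol K fullSet ≡ a * b + b * a
  vol-full = trans (sumFin-cong deg-side) (trans (sumFin-sides (λ s _ → degreeOn s))
    (cong₂ _+_ (sumFin-const {a} b) (sumFin-const {b} a)))

  module Counts (S : Subset (a + b)) where
    x x′ y y′ : ℕ
    x  = sumFin (λ i → 𝟙 (S (i ↑ˡ b)))
    x′ = sumFin (λ i → 𝟙 (not (S (i ↑ˡ b))))
    y  = sumFin (λ j → 𝟙 (S (a ↑ʳ j)))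
    y′ = sumFin (λ j → 𝟙 (not (S (a ↑ʳ j))))

    𝟙+𝟙not : ∀ s → 𝟙 s + 𝟙 (not s) ≡ 1
    𝟙+𝟙not true  = refl
    𝟙+𝟙not false = refl

    x+x′ : x + x′ ≡ a
    x+x′ = trans (sym (sumFin-+ {a} _ _)) (trans (sumFin-cong (λ i → 𝟙+𝟙not (S (i ↑ˡ b)))) (sumFin-one {a}))

    y+y′ : y + y′ ≡ b
    y+y′ = trans (sym (sumFin-+ {b} _ _)) (trans (sumFin-cong (λ j → 𝟙+𝟙not (S (a ↑ʳ j)))) (sumFin-one {b}))

    if≡𝟙* : ∀ s d → (if s then d else 0) ≡ 𝟙 s * d
    if≡𝟙* true  d = sym (+-identityʳ d)
    if≡𝟙* false d = refl

    vol≡ : vol K S ≡ x * b + y * a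
    vol≡ = trans (sumFin-cong (λ u → trans (cong (λ d → if S u then d else 0) (deg-side u)) (if≡𝟙* (S u) _)))
      (trans (sumFin-sides (λ s u → 𝟙 (S u) * degreeOn s)) (cong₂ _+_ (sumFin-*ʳ {a} _ b) (sumFin-*ʳ {b} _ a)))

    crossing : ∀ p q → 𝟙 (p ∧ not q ∧ true) ≡ 𝟙 p * 𝟙 (not q)
    crossing true  true  = refl
    crossing true  false = refl
    crossing false _     = refl

    same-side : ∀ p q → 𝟙 (p ∧ not q ∧ false) ≡ 0
    same-side true  true  = refl
    same-side true  false = refl
    same-side false _     = refl

    leaving : ∀ s u → sumFin (λ v → 𝟙 (S u ∧ not (S v) ∧ (s xor side v))) ≡ 𝟙 (S u) * (if s then y′ else x′)
    leaving true u = trans (sumFin-sides (λ t v → 𝟙 (S u ∧ not (S v) ∧ (true xor t))))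
      (cong₂ _+_ (trans (sumFin-cong (λ i → same-side (S u) (S (i ↑ˡ b)))) (sumFin-zero {a}))
                 (trans (sumFin-cong (λ j → crossing (S u) (S (a ↑ʳ j)))) (sumFin-*ˡ {b} (𝟙 (S u)) _)))
    leaving false u = trans (sumFin-sides (λ t v → 𝟙 (S u ∧ not (S v) ∧ (false xor t))))
      (trans (cong₂ _+_ (trans (sumFin-cong (λ i → crossing (S u) (S (i ↑ˡ b)))) (sumFin-*ˡ {a} (𝟙 (S u)) _))
                        (trans (sumFin-cong (λ j → same-side (S u) (S (a ↑ʳ j)))) (sumFin-zero {b})))
             (+-identityʳ _))

    cut≡ : cut K S ≡ x * y′ + y * x′
    cut≡ = trans (sumFin-cong (λ u → leaving (side u) u))
      (trans (sumFin-sides (λ s u → 𝟙 (S u) * (if s then y′ else x′)))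
             (cong₂ _+_ (sumFin-*ʳ {a} _ y′) (sumFin-*ʳ {b} _ x′)))

  vol≤2cut : ∀ S → Admissible K S → vol K S ≤ 2 * cut K S
  vol≤2cut S (_ , half) = subst₂ _≤_ (trans (cong₂ (λ p q → x * q + y * p) x+x′ y+y′) (sym vol≡)) (cong (2 *_) (sym cut≡))
    (bipartite-vol≤2cut x x′ y y′
      (subst₂ _≤_ (cong (2 *_) (trans vol≡ (cong₂ (λ p q → x * q + y * p) (sym x+x′) (sym y+y′))))
                  (trans vol-full (cong₂ (λ p q → p * q + q * p) (sym x+x′) (sym y+y′)))
                  half))
    where open Counts S

  across : ∀ {u v} → side u ≡ true → side v ≡ false → adj K u v ≡ true
  across su sv rewrite su | sv = refl

  across′ : ∀ {u v} → side u ≡ false → side v ≡ true → adj K u v ≡ true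
  across′ su sv rewrite su | sv = refl

  -- Each round is a matching across the two sides, so at most a right vertices learn per round.
  rightInformed : Subset (a + b) → ℕ
  rightInformed I = sumFin (λ u → 𝟙 (not (side u) ∧ I u))

  rightInformed-stepRound : (r : Round K) (I : Subset (a + b)) → rightInformed (stepRound r I) ≤ rightInformed I + a
  rightInformed-stepRound r I = begin
      rightInformed (stepRound r I)
    ≤⟨ sumFin-mono pointwise ⟩
      sumFin (λ u → 𝟙 (not (side u) ∧ I u) + 𝟙 (learnFrom side (partner r u)))
    ≡⟨ sumFin-+ {a + b} _ _ ⟩
      rightInformed I + sumFin (λ u → 𝟙 (learnFrom side (partner r u)))
    ≡⟨ cong (rightInformed I +_) (learners-count r side) ⟩
      rightInformed I + sumFin (λ u → 𝟙 (matched (partner r u) ∧ side u))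
    ≤⟨ +-monoʳ-≤ (rightInformed I) (sumFin-mono (λ u → ∧-𝟙≤ (matched (partner r u)) (side u))) ⟩
      rightInformed I + size side
    ≡⟨ cong (rightInformed I +_) size-side ⟩
      rightInformed I + a
    ∎
    where
    open ≤-Reasoning
    ∧-𝟙≤ : ∀ p q → 𝟙 (p ∧ q) ≤ 𝟙 q
    ∧-𝟙≤ true  q = ≤-refl
    ∧-𝟙≤ false q = z≤n
    partner-left : ∀ u w → side u ≡ false → partner r u ≡ just w → side w ≡ true
    partner-left u w su puw with side w | onEdge r u w puw
    ... | true  | _ = refl
    ... | false | e with () ← trans (sym e) (cong (_xor false) su)
    pointwise : ∀ u → 𝟙 (not (side u) ∧ (I u ∨ learnFrom I (partner r u))) ≤
                      𝟙 (not (side u) ∧ I u) + 𝟙 (learnFrom side (partner r u))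
    pointwise u with side u in su | I u
    ... | true  | _    = z≤n
    ... | false | true = s≤s z≤n
    ... | false | false with partner r u in pu
    ...   | nothing = z≤n
    ...   | just w with I w
    ...     | false = z≤n
    ...     | true  = ≤-reflexive (cong 𝟙 (sym (partner-left u w su pu)))

  rightInformed-runRounds : ∀ {T} (rs : Vec (Round K) T) I → rightInformed (runRounds rs I) ≤ rightInformed I + T * a
  rightInformed-runRounds []               I = ≤-reflexive (sym (+-identityʳ _))
  rightInformed-runRounds {suc T} (r ∷ rs) I = begin
    rightInformed (runRounds rs (stepRound r I)) ≤⟨ rightInformed-runRounds rs (stepRound r I) ⟩
    rightInformed (stepRound r I) + T * a        ≤⟨ +-monoˡ-≤ (T * a) (rightInformed-stepRound r I) ⟩
    rightInformed I + a + T * a                  ≡⟨ +-assoc (rightInformed I) a (T * a) ⟩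
    rightInformed I + suc T * a                  ∎
    where open ≤-Reasoning

  rightInformed-initial : ∀ i → rightInformed (initial (i ↑ˡ b)) ≡ 0
  rightInformed-initial i = trans (sumFin-cong pointwise) (sumFin-zero {a + b})
    where
    pointwise : ∀ u → 𝟙 (not (side u) ∧ ⌊ u ≟ i ↑ˡ b ⌋) ≡ 0
    pointwise u with u ≟ i ↑ˡ b
    ... | yes refl rewrite side-↑ˡ i = refl
    ... | no _ with side u
    ...   | true  = refl
    ...   | false = refl

  b≤T*a : ∀ i T → SolvableIn K (i ↑ˡ b) T → b ≤ T * a
  b≤T*a i T (rs , informsAll) = begin
    b                                            ≡⟨ sym size-∁side ⟩
    size (∁ side)                                ≡⟨ sumFin-cong pointwise ⟩
    rightInformed (runRounds rs (initial s₀))    ≤⟨ rightInformed-runRounds rs (initial s₀) ⟩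
    rightInformed (initial s₀) + T * a           ≡⟨ cong (_+ T * a) (rightInformed-initial i) ⟩
    T * a                                        ∎
    where
    open ≤-Reasoning
    s₀ = i ↑ˡ b
    pointwise : ∀ u → 𝟙 (not (side u)) ≡ 𝟙 (not (side u) ∧ runRounds rs (initial s₀) u)
    pointwise u rewrite informsAll u with side u
    ... | true  = refl
    ... | false = refl

  module Nonempty (a>0 : 0 < a) (b>0 : 0 < b) where

    left₀ right₀ : Fin (a + b)
    left₀  = fromℕ< a>0 ↑ˡ b
    right₀ = a ↑ʳ fromℕ< b>0

    minDegree : a ≤ b → MinDegree K a
    minDegree a≤b = (λ u → subst (a ≤_) (sym (deg-side u)) (a≤degreeOn (side u))) ,
                    right₀ , trans (deg-side right₀) (cong degreeOn (side-↑ʳ _))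
      where
      a≤degreeOn : ∀ s → a ≤ degreeOn s
      a≤degreeOn true  = a≤b
      a≤degreeOn false = ≤-refl

    maxDegree : a ≤ b → MaxDegree K b
    maxDegree a≤b = (λ u → subst (_≤ b) (sym (deg-side u)) (degreeOn≤b (side u))) ,
                    left₀ , trans (deg-side left₀) (cong degreeOn (side-↑ˡ _))
      where
      degreeOn≤b : ∀ s → degreeOn s ≤ b
      degreeOn≤b true  = ≤-refl
      degreeOn≤b false = a≤b

    connected : Connected K
    connected u v with side u in su | side v in sv
    ... | true  | false = step (across su sv) here
    ... | false | true  = step (across′ su sv) here
    ... | true  | true  = step (across su (side-↑ʳ (fromℕ< b>0))) (step (across′ (side-↑ʳ (fromℕ< b>0)) sv) here)
    ... | false | false = step (across′ su (side-↑ˡ (fromℕ< a>0))) (step (across (side-↑ˡ (fromℕ< a>0)) sv) here)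

    side-admissible : Admissible K side
    side-admissible = subst (0 <_) (sym vol-side) (*-mono-≤ a>0 b>0) ,
                      subst₂ _≤_ (cong (2 *_) (sym vol-side)) (sym vol-full) (≤-reflexive (double a b))
      where
      open Counts side
      vol-side : vol K side ≡ a * b
      vol-side = trans vol≡ (trans (cong₂ (λ p q → p * b + q * a)
        (trans (sumFin-cong (λ i → cong 𝟙 (side-↑ˡ i))) (sumFin-one {a}))
        (trans (sumFin-cong (λ j → cong 𝟙 (side-↑ʳ j))) (sumFin-zero {b}))) (+-identityʳ _))
      double : ∀ a b → 2 * (a * b) ≡ a * b + b * a
      double = solve-∀

½*2x≡x : ∀ x → ½ *ℚ (ℕtoℚ 2 *ℚ x) ≡ x
½*2x≡x x = trans (sym (ℚP.*-assoc ½ (ℕtoℚ 2) x)) (ℚP.*-identityˡ x)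

lower-bound : ∀ (δ Δ : ℕ) → 1 ≤ δ → δ ≤ Δ →
  Σ ℕ λ n → Σ (Graph n) λ G → Connected G × MinDegree G δ × MaxDegree G Δ ×
    (Σ ℚ λ φ → IsConductance G φ ×
      (Σ (Fin n) λ s → ∀ T → SolvableIn G s T → ½ *ℚ ℕtoℚ Δ ≤ℚ ℕtoℚ T *ℚ ℕtoℚ δ *ℚ φ))
lower-bound δ Δ δ≥1 δ≤Δ =
  δ + Δ , K , connected , minDegree δ≤Δ , maxDegree δ≤Δ , φ , isφ , left₀ , T-lower
  where
  open CompleteBipartite δ Δ
  open Nonempty δ≥1 (≤-trans δ≥1 δ≤Δ)
  φ = proj₁ (conductance-exists K side side-admissible)
  isφ = proj₂ (conductance-exists K side side-admissible)
  S₀ = proj₁ (proj₁ isφ)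
  adm₀ = proj₁ (proj₂ (proj₁ isφ))
  open Ratio {cut K S₀} {vol K S₀} {φ} (proj₁ adm₀) (proj₂ (proj₂ (proj₁ isφ)))

  T-lower : ∀ T → SolvableIn K left₀ T → ½ *ℚ ℕtoℚ Δ ≤ℚ ℕtoℚ T *ℚ ℕtoℚ δ *ℚ φ
  T-lower T solves = subst (½ *ℚ ℕtoℚ Δ ≤ℚ_) ½*[2Tδ]φ≡Tδφ
    (ℚP.*-monoˡ-≤-nonNeg ½ (≤*φ⇐ (2 * (T * δ)) Δ (begin
      Δ * vol K S₀                 ≤⟨ *-mono-≤ (b≤T*a (fromℕ< δ≥1) T solves) (vol≤2cut S₀ adm₀) ⟩
      T * δ * (2 * cut K S₀)       ≡⟨ regroup (T * δ) (cut K S₀) ⟩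
      2 * (T * δ) * cut K S₀       ∎)))
    where
    open ≤-Reasoning
    regroup : ∀ t c → t * (2 * c) ≡ 2 * t * c
    regroup = solve-∀
    ½*[2Tδ]φ≡Tδφ : ½ *ℚ (ℕtoℚ (2 * (T * δ)) *ℚ φ) ≡ ℕtoℚ T *ℚ ℕtoℚ δ *ℚ φ
    ½*[2Tδ]φ≡Tδφ = trans (cong (λ q → ½ *ℚ (q *ℚ φ)) (ℕtoℚ-* 2 (T * δ)))
      (trans (cong (½ *ℚ_) (ℚP.*-assoc (ℕtoℚ 2) (ℕtoℚ (T * δ)) φ))
        (trans (½*2x≡x (ℕtoℚ (T * δ) *ℚ φ)) (cong (_*ℚ φ) (ℕtoℚ-* T δ))))

theorem2 : (Σ ℚ λ c → Positive c ×
    (∀ (δ Δ : ℕ) → 1 ≤ δ → δ ≤ Δ →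
      Σ ℕ λ n → Σ (Graph n) λ G → Connected G × MinDegree G δ × MaxDegree G Δ ×
        (Σ ℚ λ φ → IsConductance G φ ×
          (Σ (Fin n) λ s → ∀ T → SolvableIn G s T →
            c *ℚ ℕtoℚ Δ ≤ℚ ℕtoℚ T *ℚ ℕtoℚ δ *ℚ φ))))
  ×
  (Σ ℚ λ C → Positive C ×
    (∀ (n : ℕ) (G : Graph n) (δ Δ : ℕ) (φ : ℚ) → Connected G → 1 ≤ δ →
      MinDegree G δ → MaxDegree G Δ → IsConductance G φ →
      ∀ (s : Fin n) → Σ ℕ λ T → SolvableIn G s T ×
        (ℕtoℚ T *ℚ ℕtoℚ δ *ℚ φ ≤ℚ C *ℚ ℕtoℚ Δ *ℚ ℕtoℚ ⌈log₂ n ⌉)))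
theorem2 = (½ , _ , lower-bound) , (ℕtoℚ 6 , ℕtoℚ-pos {6} (s≤s z≤n) , upper-bound)
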